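{- Let $a,b$ be nonzero real numbers. For every non-negative integer $i$, \[ \phi^{a,b}_i(x)=\left(\frac a2\right)^i\sum_{m=0}^{\lfloor i/2\rfloor}\frac{\binom im(i-2m+1)}{i-m+1}\ {}_2F_1\!\left(-m,\,-i+m-1;\,-i;\,-\frac{4b}{a^2}\right)U_{i-2m}(x). \]
   Context: $\phi^{a,b}_0(x)=1$, $\phi^{a,b}_1(x)=ax$, $\phi^{a,b}_j(x)=ax\,\phi^{a,b}_{j-1}(x)+b\,\phi^{a,b}_{j-2}(x)$ for $j\ge2$. $U_j$ are the Chebyshev polynomials of the second kind ($U_0=1$, $U_1=2x$, $U_j=2xU_{j-1}-U_{j-2}$). For a non-negative integer $m$, ${}_2F_1(-m,\beta;\gamma;z)=\sum_{k=0}^{m}\frac{(-m)_k(\beta)_k}{(\gamma)_k}\frac{z^k}{k!}$ with $(u)_k=u(u+1)\cdots(u+k-1)$, $(u)_0=1$. -}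

module Defs where

open import Level using (0ℓ)
open import Data.Nat as ℕ using (ℕ; zero; suc)
open import Data.Product using (∃; _×_)
open import Relation.Binary.PropositionalEquality using (_≡_; _≢_)
open import Relation.Binary.Structures using (IsTotalOrder)
open import Algebra.Structures using (IsCommutativeRing)
open import Data.Nat.Combinatorics using (_C_)

record RealField : Set₁ where
  infixl 6 _+_
  infixl 7 _*_
  infix  8 -_
  infix  4 _≤_
  field
    Carrier : Set
    _+_ _*_ : Carrier → Carrier → Carrier
    -_      : Carrier → Carrier
    0# 1#   : Carrier
    _⁻¹     : Carrier → Carrier
    _≤_     : Carrier → Carrier → Set
    isCommutativeRing : IsCommutativeRing _≡_ _+_ _*_ -_ 0# 1#
    0≢1     : 0# ≢ 1#
    ⁻¹-inverse : ∀ x → x ≢ 0# → x * (x ⁻¹) ≡ 1#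
    isTotalOrder : IsTotalOrder _≡_ _≤_
    +-mono-≤ : ∀ x y z → x ≤ y → x + z ≤ y + z
    *-nonneg : ∀ x y → 0# ≤ x → 0# ≤ y → 0# ≤ x * y
    complete : (P : Carrier → Set) → ∃ P → ∃ (λ u → ∀ x → P x → x ≤ u) →
               ∃ (λ s → (∀ x → P x → x ≤ s) × (∀ u → (∀ x → P x → x ≤ u) → s ≤ u))

module Poly (R : RealField) where
  open RealField R public

  infixl 7 _/_
  _/_ : Carrier → Carrier → Carrier
  x / y = x * (y ⁻¹)

  infixr 8 _^_
  _^_ : Carrier → ℕ → Carrier
  x ^ zero  = 1#
  x ^ suc n = x * (x ^ n)

  ι : ℕ → Carrier
  ι zero    = 0#
  ι (suc n) = 1# + ι n

  sumTo : ℕ → (ℕ → Carrier) → Carrier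
  sumTo zero    f = f 0
  sumTo (suc n) f = sumTo n f + f (suc n)

  poch : Carrier → ℕ → Carrier
  poch u zero    = 1#
  poch u (suc k) = poch u k * (u + ι k)

  fact : ℕ → Carrier
  fact zero    = 1#
  fact (suc k) = fact k * ι (suc k)

  -- ₂F₁(-m, β; γ; z) = Σ_{k=0}^{m} (-m)_k (β)_k / (γ)_k · z^k / k!
  F21 : ℕ → Carrier → Carrier → Carrier → Carrier
  F21 m β γ z = sumTo m (λ k → (poch (- ι m) k * poch β k) / poch γ k * (z ^ k) / fact k)

  φ : Carrier → Carrier → ℕ → Carrier → Carrier
  φ a b zero          x = 1#
  φ a b (suc zero)    x = a * x
  φ a b (suc (suc j)) x = a * x * φ a b (suc j) x + b * φ a b j x

  U : ℕ → Carrier → Carrier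
  U zero          x = 1#
  U (suc zero)    x = ι 2 * x
  U (suc (suc j)) x = ι 2 * x * U (suc j) x + - U j x

  binom : ℕ → ℕ → Carrier
  binom n k = ι (n C k)

module Submission where

-- With h = a/2 and w = 4b/a² one has φ^{a,b}_i = h^i V_i, where V_i = φ^{2,w}_i satisfies
-- V_{i+2} = 2x V_{i+1} + w V_i.  Since 2x U_r = U_{r+1} + U_{r-1} (with U_{-1} = 0), expanding V_i in the
-- U-basis counts walks that never go below height 0: up and down steps use one unit of i, level steps use
-- two units and carry a factor w.  The coefficient of U_{i-2m} is therefore Σ_k N(s,k) w^k with s + k = m,
-- where N(s,k) counts walks to height i - 2m with s down-steps and k level steps.  These numbers have a
-- ballot-type closed form, (q+1)(q+2s+k)! / (k! s! (q+s+1)!) for endpoint q, so the ratio of consecutive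
-- terms N(m-k-1,k+1) w^{k+1} / N(m-k,k) w^k is precisely the term ratio of ₂F₁(-m, -i+m-1; -i; -w), and
-- N(m,0) is the ballot number C(i,m)(i-2m+1)/(i-m+1) in front of it.

open import Defs
open import Data.Nat as ℕ using (ℕ; zero; suc)
open import Relation.Binary.PropositionalEquality
  using (_≡_; _≢_; refl; sym; trans; cong; cong₂; subst; subst₂; module ≡-Reasoning)

open import Level using (0ℓ)
open import Data.Product using (_×_; _,_; proj₁; proj₂)
open import Data.Sum using (inj₁; inj₂)
import Data.Nat.Properties as ℕ
open import Data.Nat.Combinatorics using (_C_)
open import Data.Nat.DivMod using (m%n<n)
open import Data.Nat.Tactic.RingSolver using (solve-∀)
open import Algebra.Bundles using (CommutativeRing)
open import Algebra.Structures using (IsCommutativeRing)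
open import Relation.Binary.Structures using (IsTotalOrder)
open ≡-Reasoning

module _ where
  open import Data.Nat
  open import Data.Nat.Properties
  open import Data.Nat.Combinatorics using (nCk≡n!/k![n-k]!; k![n∸k]!∣n!)
  open import Data.Nat.DivMod using (_/_; _%_; m/n*n≡m; m/n*n≤m; m≡m%n+[m/n]*n)

  -- paths q s k counts walks from height 0 to height q - 1 that never go below 0, made of q - 1 + s
  -- up-steps, s down-steps and k level steps; q = 0 encodes the unreachable height -1.
  paths : ℕ → ℕ → ℕ → ℕ
  paths zero    s       k       = 0
  paths (suc q) zero    zero    = 1
  paths (suc q) (suc s) zero    = paths q (suc s) zero + paths (suc (suc q)) s zero
  paths (suc q) zero    (suc k) = paths q zero (suc k) + paths (suc q) zero k
  paths (suc q) (suc s) (suc k) =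
    paths q (suc s) (suc k) + paths (suc (suc q)) s (suc k) + paths (suc q) (suc s) k

  den : ℕ → ℕ → ℕ → ℕ
  den q s k = k ! * s ! * (q + s) !

  num : ℕ → ℕ → ℕ → ℕ
  num zero    s k = 0
  num (suc q) s k = suc q * (q + 2 * s + k) !

  num-≡ : ∀ q s k {L} → q + 2 * s + k ≡ suc L → num q s k ≡ q * L !
  num-≡ zero    s k eq = refl
  num-≡ (suc q) s k eq = cong (λ n → suc q * n !) (suc-injective eq)

  den-up : ∀ q s k → den q s k * suc (q + s) ≡ den (suc q) s k
  den-up q s k = rearrange (k !) (s !) ((q + s) !) (suc (q + s))
    where
    rearrange : ∀ a b c n → a * b * c * n ≡ a * b * (n * c)
    rearrange = solve-∀

  den-down : ∀ q s k → den (suc (suc q)) s k * suc s ≡ den (suc q) (suc s) k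
  den-down q s k = begin
    k ! * s ! * (suc (suc q) + s) ! * suc s ≡⟨ rearrange (k !) (s !) _ s ⟩
    k ! * (suc s) ! * (suc (suc q) + s) !   ≡⟨ cong (λ n → k ! * (suc s) ! * n !) (sym (+-suc (suc q) s)) ⟩
    k ! * (suc s) ! * (suc q + suc s) !     ∎
    where
    rearrange : ∀ a b c s → a * b * c * suc s ≡ a * (suc s * b) * c
    rearrange = solve-∀

  den-level : ∀ q s k → den q s k * suc k ≡ den q s (suc k)
  den-level q s k = rearrange (k !) (s !) ((q + s) !) k
    where
    rearrange : ∀ a b c k → a * b * c * suc k ≡ suc k * a * b * c
    rearrange = solve-∀

  paths-closed : ∀ q s k → paths q s k * den q s k ≡ num q s k

  paths-scaled : ∀ q s k {e d} → den q s k * e ≡ d → paths q s k * d ≡ num q s k * e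
  paths-scaled q s k {e} refl = begin
    paths q s k * (den q s k * e) ≡⟨ *-assoc (paths q s k) (den q s k) e ⟨
    paths q s k * den q s k * e   ≡⟨ cong (_* e) (paths-closed q s k) ⟩
    num q s k * e                 ∎

  paths-closed zero    s       k       = refl
  paths-closed (suc q) zero    zero    = begin
    1 * (1 * 1 * (suc q + 0) !) ≡⟨ cong (λ n → 1 * (1 * 1 * n !)) (+-identityʳ (suc q)) ⟩
    1 * (1 * 1 * (suc q * q !)) ≡⟨ unit (suc q * q !) ⟩
    suc q * q !                 ≡⟨ sym (num-≡ (suc q) 0 0 (shape q)) ⟩
    num (suc q) 0 0             ∎
    where
    unit : ∀ n → 1 * (1 * 1 * n) ≡ n
    unit = solve-∀
    shape : ∀ q → suc q + 2 * 0 + 0 ≡ suc q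
    shape = solve-∀
  paths-closed (suc q) (suc s) zero    = begin
    (paths q (suc s) 0 + paths (suc (suc q)) s 0) * den (suc q) (suc s) 0
      ≡⟨ *-distribʳ-+ (den (suc q) (suc s) 0) (paths q (suc s) 0) _ ⟩
    _ ≡⟨ cong₂ _+_ (paths-scaled q (suc s) 0 (den-up q (suc s) 0))
                   (paths-scaled (suc (suc q)) s 0 (den-down q s 0)) ⟩
    num q (suc s) 0 * suc (q + suc s) + num (suc (suc q)) s 0 * suc s
      ≡⟨ cong₂ (λ u v → u * suc (q + suc s) + v * suc s)
               (num-≡ q (suc s) 0 (shape₁ q s)) (num-≡ (suc (suc q)) s 0 (shape₂ q s)) ⟩
    q * F * suc (q + suc s) + suc (suc q) * F * suc s ≡⟨ identity q s F ⟩
    suc q * (suc L * F)                                ≡⟨ sym (num-≡ (suc q) (suc s) 0 (shape₃ q s)) ⟩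
    num (suc q) (suc s) 0                              ∎
    where
    L = q + 2 * s + 1
    F = L !
    shape₁ : ∀ q s → q + 2 * suc s + 0 ≡ suc (q + 2 * s + 1)
    shape₁ = solve-∀
    shape₂ : ∀ q s → suc (suc q) + 2 * s + 0 ≡ suc (q + 2 * s + 1)
    shape₂ = solve-∀
    shape₃ : ∀ q s → suc q + 2 * suc s + 0 ≡ suc (suc (q + 2 * s + 1))
    shape₃ = solve-∀
    identity : ∀ q s F → q * F * suc (q + suc s) + suc (suc q) * F * suc s
                         ≡ suc q * (suc (q + 2 * s + 1) * F)
    identity = solve-∀
  paths-closed (suc q) zero    (suc k) = begin
    (paths q 0 (suc k) + paths (suc q) 0 k) * den (suc q) 0 (suc k)
      ≡⟨ *-distribʳ-+ (den (suc q) 0 (suc k)) (paths q 0 (suc k)) _ ⟩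
    _ ≡⟨ cong₂ _+_ (paths-scaled q 0 (suc k) (den-up q 0 (suc k)))
                   (paths-scaled (suc q) 0 k (den-level (suc q) 0 k)) ⟩
    num q 0 (suc k) * suc (q + 0) + num (suc q) 0 k * suc k
      ≡⟨ cong₂ (λ u v → u * suc (q + 0) + v * suc k)
               (num-≡ q 0 (suc k) (shape₁ q k)) (num-≡ (suc q) 0 k (shape₂ q k)) ⟩
    q * F * suc (q + 0) + suc q * F * suc k ≡⟨ identity q k F ⟩
    suc q * (suc (q + k) * F)               ≡⟨ sym (num-≡ (suc q) 0 (suc k) (shape₃ q k)) ⟩
    num (suc q) 0 (suc k)                   ∎
    where
    F = (q + k) !
    shape₁ : ∀ q k → q + 2 * 0 + suc k ≡ suc (q + k)
    shape₁ = solve-∀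
    shape₂ : ∀ q k → suc q + 2 * 0 + k ≡ suc (q + k)
    shape₂ = solve-∀
    shape₃ : ∀ q k → suc q + 2 * 0 + suc k ≡ suc (suc (q + k))
    shape₃ = solve-∀
    identity : ∀ q k F → q * F * suc (q + 0) + suc q * F * suc k ≡ suc q * (suc (q + k) * F)
    identity = solve-∀
  paths-closed (suc q) (suc s) (suc k) = begin
    (paths q (suc s) (suc k) + paths (suc (suc q)) s (suc k) + paths (suc q) (suc s) k)
      * den (suc q) (suc s) (suc k)
      ≡⟨ distrib₃ (paths q (suc s) (suc k)) _ _ (den (suc q) (suc s) (suc k)) ⟩
    _ ≡⟨ cong₂ _+_ (cong₂ _+_ (paths-scaled q (suc s) (suc k) (den-up q (suc s) (suc k)))
                              (paths-scaled (suc (suc q)) s (suc k) (den-down q s (suc k))))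
                   (paths-scaled (suc q) (suc s) k (den-level (suc q) (suc s) k)) ⟩
    num q (suc s) (suc k) * suc (q + suc s) + num (suc (suc q)) s (suc k) * suc s
      + num (suc q) (suc s) k * suc k
      ≡⟨ cong₂ _+_ (cong₂ _+_ (cong (_* suc (q + suc s)) (num-≡ q (suc s) (suc k) (shape₁ q s k)))
                              (cong (_* suc s) (num-≡ (suc (suc q)) s (suc k) (shape₂ q s k))))
                   (cong (_* suc k) (num-≡ (suc q) (suc s) k (shape₃ q s k))) ⟩
    q * F * suc (q + suc s) + suc (suc q) * F * suc s + suc q * F * suc k ≡⟨ identity q s k F ⟩
    suc q * (suc L * F)    ≡⟨ sym (num-≡ (suc q) (suc s) (suc k) (shape₄ q s k)) ⟩
    num (suc q) (suc s) (suc k) ∎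
    where
    L = q + 2 * s + k + 2
    F = L !
    distrib₃ : ∀ a b c d → (a + b + c) * d ≡ a * d + b * d + c * d
    distrib₃ = solve-∀
    shape₁ : ∀ q s k → q + 2 * suc s + suc k ≡ suc (q + 2 * s + k + 2)
    shape₁ = solve-∀
    shape₂ : ∀ q s k → suc (suc q) + 2 * s + suc k ≡ suc (q + 2 * s + k + 2)
    shape₂ = solve-∀
    shape₃ : ∀ q s k → suc q + 2 * suc s + k ≡ suc (q + 2 * s + k + 2)
    shape₃ = solve-∀
    shape₄ : ∀ q s k → suc q + 2 * suc s + suc k ≡ suc (suc (q + 2 * s + k + 2))
    shape₄ = solve-∀
    identity : ∀ q s k F →
      q * F * suc (q + suc s) + suc (suc q) * F * suc s + suc q * F * suc k
        ≡ suc q * (suc (q + 2 * s + k + 2) * F)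
    identity = solve-∀

  binomial-factorials : ∀ k j → ((k + j) C k) * (k ! * j !) ≡ (k + j) !
  binomial-factorials k j = begin
    ((k + j) C k) * (k ! * j !)               ≡⟨ cong (λ n → ((k + j) C k) * (k ! * n !)) (m+n∸m≡n k j) ⟨
    ((k + j) C k) * (k ! * (k + j ∸ k) !)     ≡⟨ cong (_* (k ! * (k + j ∸ k) !)) (nCk≡n!/k![n-k]! k≤k+j) ⟩
    (k + j) ! / (k ! * (k + j ∸ k) !) * (k ! * (k + j ∸ k) !)
                                            ≡⟨ m/n*n≡m (k![n∸k]!∣n! k≤k+j) ⟩
    (k + j) !                               ∎
    where
    k≤k+j = m≤m+n k j
    instance _ = k !* (k + j ∸ k) !≢0

  paths-ballot : ∀ r m → ((r + 2 * m) C m) * suc r ≡ paths (suc r) m 0 * suc (r + m)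
  paths-ballot r m = *-cancelʳ-≡ _ _ (m ! * (r + m) !) (begin
    ((r + 2 * m) C m) * suc r * (m ! * (r + m) !)
      ≡⟨ swap ((r + 2 * m) C m) (suc r) (m ! * (r + m) !) ⟩
    ((r + 2 * m) C m) * (m ! * (r + m) !) * suc r
      ≡⟨ cong (λ n → (n C m) * (m ! * (r + m) !) * suc r) (split r m) ⟩
    ((m + (r + m)) C m) * (m ! * (r + m) !) * suc r ≡⟨ cong (_* suc r) (binomial-factorials m (r + m)) ⟩
    (m + (r + m)) ! * suc r                       ≡⟨ cong (λ n → n ! * suc r) (split r m) ⟨
    (r + 2 * m) ! * suc r                         ≡⟨ *-comm ((r + 2 * m) !) (suc r) ⟩
    suc r * (r + 2 * m) !                         ≡⟨ num-≡ (suc r) m 0 (shape r m) ⟨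
    num (suc r) m 0                               ≡⟨ paths-closed (suc r) m 0 ⟨
    paths (suc r) m 0 * den (suc r) m 0           ≡⟨ unfold (paths (suc r) m 0) (m !) ((r + m) !) (r + m) ⟩
    paths (suc r) m 0 * suc (r + m) * (m ! * (r + m) !) ∎)
    where
    instance _ = m !* (r + m) !≢0
    swap : ∀ a b c → a * b * c ≡ a * c * b
    swap = solve-∀
    split : ∀ r m → r + 2 * m ≡ m + (r + m)
    split = solve-∀
    shape : ∀ r m → suc r + 2 * m + 0 ≡ suc (r + 2 * m)
    shape = solve-∀
    unfold : ∀ p a b n → p * (1 * a * (suc n * b)) ≡ p * suc n * (a * b)
    unfold = solve-∀

  den-two-up : ∀ r s k → den (suc r) s k * (suc s * suc (suc (r + s))) ≡ den (suc r) (suc s) k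
  den-two-up r s k = begin
    den (suc r) s k * (suc s * suc (suc (r + s))) ≡⟨ swap (den (suc r) s k) (suc s) _ ⟩
    den (suc r) s k * suc (suc (r + s)) * suc s   ≡⟨ cong (_* suc s) (den-up (suc r) s k) ⟩
    den (suc (suc r)) s k * suc s                 ≡⟨ den-down r s k ⟩
    den (suc r) (suc s) k                         ∎
    where
    swap : ∀ d a b → d * (a * b) ≡ d * b * a
    swap = solve-∀

  paths-ratio : ∀ r s k →
    paths (suc r) s (suc k) * (suc (suc (r + 2 * s + k)) * suc k)
      ≡ paths (suc r) (suc s) k * (suc s * suc (suc (r + s)))
  paths-ratio r s k = *-cancelʳ-≡ _ _ D (begin
    P₁ * (suc N * suc k) * D              ≡⟨ swap P₁ (suc N) (suc k) D ⟩
    P₁ * (D * suc k) * suc N              ≡⟨ cong (λ d → P₁ * d * suc N) (den-level (suc r) s k) ⟩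
    P₁ * den (suc r) s (suc k) * suc N    ≡⟨ cong (_* suc N) (paths-closed (suc r) s (suc k)) ⟩
    num (suc r) s (suc k) * suc N         ≡⟨ cong (_* suc N) (num-≡ (suc r) s (suc k) (shape₁ r s k)) ⟩
    suc r * N ! * suc N                   ≡⟨ grow (suc r) (N !) N ⟩
    suc r * (suc N) !                     ≡⟨ num-≡ (suc r) (suc s) k (shape₂ r s k) ⟨
    num (suc r) (suc s) k                 ≡⟨ paths-closed (suc r) (suc s) k ⟨
    P₂ * den (suc r) (suc s) k            ≡⟨ cong (P₂ *_) (den-two-up r s k) ⟨
    P₂ * (D * (suc s * suc (suc (r + s)))) ≡⟨ swap′ P₂ D (suc s) (suc (suc (r + s))) ⟩
    P₂ * (suc s * suc (suc (r + s))) * D  ∎)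
    where
    N = suc (r + 2 * s + k)
    P₁ = paths (suc r) s (suc k)
    P₂ = paths (suc r) (suc s) k
    D = den (suc r) s k
    instance _ = m*n≢0 (k ! * s !) ((suc r + s) !) {{k !* s !≢0}} {{(suc r + s) !≢0}}
    swap : ∀ p a b d → p * (a * b) * d ≡ p * (d * b) * a
    swap = solve-∀
    swap′ : ∀ p d a b → p * (d * (a * b)) ≡ p * (a * b) * d
    swap′ = solve-∀
    grow : ∀ a F n → a * F * suc n ≡ a * (suc n * F)
    grow = solve-∀
    shape₁ : ∀ r s k → suc r + 2 * s + suc k ≡ suc (suc (r + 2 * s + k))
    shape₁ = solve-∀
    shape₂ : ∀ r s k → suc r + 2 * suc s + k ≡ suc (suc (suc (r + 2 * s + k)))
    shape₂ = solve-∀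

  degree-shift : ∀ j n m → m ≤ n → 2 * (suc n ∸ m) + j ≡ 2 * (n ∸ m) + suc (suc j)
  degree-shift j n m m≤n = begin
    2 * (suc n ∸ m) + j       ≡⟨ cong (λ d → 2 * d + j) (+-∸-assoc 1 m≤n) ⟩
    2 * suc (n ∸ m) + j       ≡⟨ shape (n ∸ m) j ⟩
    2 * (n ∸ m) + suc (suc j) ∎
    where
    shape : ∀ d j → 2 * suc d + j ≡ 2 * d + suc (suc j)
    shape = solve-∀

  degree-∸ : ∀ j n m → m ≤ n → 2 * (n ∸ m) + j ≡ 2 * n + j ∸ 2 * m
  degree-∸ j n m m≤n = begin
    2 * (n ∸ m) + j   ≡⟨ cong (_+ j) (*-distribˡ-∸ 2 n m) ⟩
    2 * n ∸ 2 * m + j ≡⟨ +-∸-comm j (*-monoʳ-≤ 2 m≤n) ⟨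
    2 * n + j ∸ 2 * m ∎

  2*[n/2]+n%2≡n : ∀ n → 2 * (n / 2) + n % 2 ≡ n
  2*[n/2]+n%2≡n n = begin
    2 * (n / 2) + n % 2 ≡⟨ +-comm (2 * (n / 2)) (n % 2) ⟩
    n % 2 + 2 * (n / 2) ≡⟨ cong (n % 2 +_) (*-comm 2 (n / 2)) ⟩
    n % 2 + n / 2 * 2   ≡⟨ m≡m%n+[m/n]*n n 2 ⟨
    n                   ∎

  m≤n/2⇒2*m≤n : ∀ {m} n → m ≤ n / 2 → 2 * m ≤ n
  m≤n/2⇒2*m≤n n m≤n/2 = ≤-trans (*-monoʳ-≤ 2 m≤n/2) (subst (_≤ n) (*-comm (n / 2) 2) (m/n*n≤m n 2))

module _ (R : RealField) where
  open Poly R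

  private
    commutativeRing : CommutativeRing 0ℓ 0ℓ
    commutativeRing = record { isCommutativeRing = isCommutativeRing }

  open IsCommutativeRing isCommutativeRing
    using (+-assoc; +-comm; +-identityˡ; +-identityʳ; -‿inverseˡ; -‿inverseʳ;
           *-assoc; *-comm; *-identityˡ; *-identityʳ; zeroˡ; distribˡ; distribʳ)
  open IsTotalOrder isTotalOrder using (antisym; total; reflexive) renaming (trans to ≤-trans)
  open import Algebra.Properties.Ring (CommutativeRing.ring commutativeRing)
    using (-‿distribˡ-*; -‿distribʳ-*)
  open import Algebra.Properties.AbelianGroup (CommutativeRing.+-abelianGroup commutativeRing)
    using (⁻¹-∙-comm; ⁻¹-involutive; ε⁻¹≈ε)
  open import Algebra.Solver.Ring.NaturalCoefficients.Default
    (CommutativeRing.commutativeSemiring commutativeRing)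

  -‿distrib-+ : ∀ x y → - (x + y) ≡ - x + - y
  -‿distrib-+ x y = sym (⁻¹-∙-comm x y)

  -x*-y≡x*y : ∀ x y → (- x) * (- y) ≡ x * y
  -x*-y≡x*y x y = begin
    (- x) * (- y)   ≡⟨ -‿distribˡ-* x (- y) ⟨
    - (x * (- y))   ≡⟨ cong -_ (-‿distribʳ-* x y) ⟨
    - (- (x * y))   ≡⟨ ⁻¹-involutive (x * y) ⟩
    x * y           ∎

  0≤1 : 0# ≤ 1#
  0≤1 with total 0# 1#
  ... | inj₁ 0≤1 = 0≤1
  ... | inj₂ 1≤0 =
    subst (0# ≤_) (trans (-x*-y≡x*y 1# 1#) (*-identityˡ 1#)) (*-nonneg (- 1#) (- 1#) 0≤-1 0≤-1)
    where
    0≤-1 : 0# ≤ - 1#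
    0≤-1 = subst₂ _≤_ (-‿inverseʳ 1#) (+-identityˡ (- 1#)) (+-mono-≤ 1# 0# (- 1#) 1≤0)

  0≤ι : ∀ n → 0# ≤ ι n
  1≤ι-suc : ∀ n → 1# ≤ ι (suc n)
  1≤ι-suc n = subst₂ _≤_ (+-identityˡ 1#) (+-comm (ι n) 1#) (+-mono-≤ 0# (ι n) 1# (0≤ι n))
  0≤ι zero    = reflexive refl
  0≤ι (suc n) = ≤-trans 0≤1 (1≤ι-suc n)

  ι-suc≢0 : ∀ n → ι (suc n) ≢ 0#
  ι-suc≢0 n ι≡0 = 0≢1 (antisym 0≤1 (subst (1# ≤_) ι≡0 (1≤ι-suc n)))

  ι-+ : ∀ m n → ι (m ℕ.+ n) ≡ ι m + ι n
  ι-+ zero    n = sym (+-identityˡ (ι n))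
  ι-+ (suc m) n = trans (cong (1# +_) (ι-+ m n)) (sym (+-assoc 1# (ι m) (ι n)))

  ι-* : ∀ m n → ι (m ℕ.* n) ≡ ι m * ι n
  ι-* zero    n = sym (zeroˡ (ι n))
  ι-* (suc m) n = begin
    ι (n ℕ.+ m ℕ.* n)    ≡⟨ ι-+ n (m ℕ.* n) ⟩
    ι n + ι (m ℕ.* n)    ≡⟨ cong (ι n +_) (ι-* m n) ⟩
    ι n + ι m * ι n      ≡⟨ solve 2 (λ a b → b :+ a :* b := (con 1 :+ a) :* b) refl (ι m) (ι n) ⟩
    (1# + ι m) * ι n     ∎

  ι-+-cancel : ∀ a b → ι (a ℕ.+ b) + - ι b ≡ ι a
  ι-+-cancel a b = begin
    ι (a ℕ.+ b) + - ι b  ≡⟨ cong (_+ - ι b) (ι-+ a b) ⟩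
    ι a + ι b + - ι b    ≡⟨ +-assoc (ι a) (ι b) (- ι b) ⟩
    ι a + (ι b + - ι b)  ≡⟨ cong (ι a +_) (-‿inverseʳ (ι b)) ⟩
    ι a + 0#             ≡⟨ +-identityʳ (ι a) ⟩
    ι a                  ∎

  -ι-+-cancel : ∀ a b → - ι (a ℕ.+ b) + ι b ≡ - ι a
  -ι-+-cancel a b = begin
    - ι (a ℕ.+ b) + ι b     ≡⟨ cong (λ y → - y + ι b) (ι-+ a b) ⟩
    - (ι a + ι b) + ι b     ≡⟨ cong (_+ ι b) (-‿distrib-+ (ι a) (ι b)) ⟩
    - ι a + - ι b + ι b     ≡⟨ +-assoc (- ι a) (- ι b) (ι b) ⟩
    - ι a + (- ι b + ι b)   ≡⟨ cong (- ι a +_) (-‿inverseˡ (ι b)) ⟩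
    - ι a + 0#              ≡⟨ +-identityʳ (- ι a) ⟩
    - ι a                   ∎

  *≡⇒≡/ : ∀ {x y z} → y ≢ 0# → x * y ≡ z → x ≡ z / y
  *≡⇒≡/ {x} {y} {z} y≢0 xy≡z = begin
    x                ≡⟨ *-identityʳ x ⟨
    x * 1#           ≡⟨ cong (x *_) (⁻¹-inverse y y≢0) ⟨
    x * (y * y ⁻¹)   ≡⟨ *-assoc x y (y ⁻¹) ⟨
    x * y * y ⁻¹     ≡⟨ cong (_* y ⁻¹) xy≡z ⟩
    z / y            ∎

  *-≢0 : ∀ {x y} → x ≢ 0# → y ≢ 0# → x * y ≢ 0#
  *-≢0 {y = y} x≢0 y≢0 xy≡0 = x≢0 (trans (*≡⇒≡/ y≢0 xy≡0) (zeroˡ (y ⁻¹)))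

  -‿≢0 : ∀ {x} → x ≢ 0# → - x ≢ 0#
  -‿≢0 {x} x≢0 -x≡0 = x≢0 (trans (sym (⁻¹-involutive x)) (trans (cong -_ -x≡0) ε⁻¹≈ε))

  -ι+ι≢0 : ∀ {j n} → j ℕ.< n → - ι n + ι j ≢ 0#
  -ι+ι≢0 {j} {n} j<n = subst (_≢ 0#) -ι[1+d]≡ (-‿≢0 (ι-suc≢0 d))
    where
    d = n ℕ.∸ suc j
    -ι[1+d]≡ : - ι (suc d) ≡ - ι n + ι j
    -ι[1+d]≡ = trans (sym (-ι-+-cancel (suc d) j))
                     (cong (λ n′ → - ι n′ + ι j) (trans (sym (ℕ.+-suc d j)) (ℕ.m∸n+n≡m j<n)))

  ⁻¹-unique : ∀ {x y} → x ≢ 0# → x * y ≡ 1# → y ≡ x ⁻¹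
  ⁻¹-unique {x} {y} x≢0 xy≡1 = trans (*≡⇒≡/ x≢0 (trans (*-comm y x) xy≡1)) (*-identityˡ (x ⁻¹))

  ⁻¹-distrib-* : ∀ {x y} → x ≢ 0# → y ≢ 0# → (x * y) ⁻¹ ≡ x ⁻¹ * y ⁻¹
  ⁻¹-distrib-* {x} {y} x≢0 y≢0 = sym (⁻¹-unique (*-≢0 x≢0 y≢0) (begin
    x * y * (x ⁻¹ * y ⁻¹)      ≡⟨ solve 4 (λ x y x′ y′ → x :* y :* (x′ :* y′) := (x :* x′) :* (y :* y′))
                                        refl x y (x ⁻¹) (y ⁻¹) ⟩
    (x * x ⁻¹) * (y * y ⁻¹)    ≡⟨ cong₂ _*_ (⁻¹-inverse x x≢0) (⁻¹-inverse y y≢0) ⟩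
    1# * 1#                    ≡⟨ *-identityˡ 1# ⟩
    1#                         ∎))

  ⁻¹-distrib-neg : ∀ {x} → x ≢ 0# → (- x) ⁻¹ ≡ - (x ⁻¹)
  ⁻¹-distrib-neg {x} x≢0 = sym (⁻¹-unique (-‿≢0 x≢0) (trans (-x*-y≡x*y x (x ⁻¹)) (⁻¹-inverse x x≢0)))

  1⁻¹≡1 : 1# ⁻¹ ≡ 1#
  1⁻¹≡1 = sym (⁻¹-unique (λ 1≡0 → 0≢1 (sym 1≡0)) (*-identityˡ 1#))

  sumTo-cong : ∀ n {f g} → (∀ k → k ℕ.≤ n → f k ≡ g k) → sumTo n f ≡ sumTo n g
  sumTo-cong zero    f≗g = f≗g 0 ℕ.z≤n
  sumTo-cong (suc n) f≗g =
    cong₂ _+_ (sumTo-cong n (λ k k≤n → f≗g k (ℕ.m≤n⇒m≤1+n k≤n))) (f≗g (suc n) ℕ.≤-refl)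

  sumTo-shift : ∀ n f → sumTo (suc n) f ≡ f 0 + sumTo n (λ k → f (suc k))
  sumTo-shift zero    f = refl
  sumTo-shift (suc n) f = trans (cong (_+ f (suc (suc n))) (sumTo-shift n f)) (+-assoc _ _ _)

  sumTo-+ : ∀ n f g → sumTo n (λ k → f k + g k) ≡ sumTo n f + sumTo n g
  sumTo-+ zero    f g = refl
  sumTo-+ (suc n) f g = trans (cong (_+ (f (suc n) + g (suc n))) (sumTo-+ n f g))
    (solve 4 (λ a b c d → a :+ b :+ (c :+ d) := a :+ c :+ (b :+ d)) refl
      (sumTo n f) (sumTo n g) (f (suc n)) (g (suc n)))

  sumTo-*ˡ : ∀ n c f → c * sumTo n f ≡ sumTo n (λ k → c * f k)
  sumTo-*ˡ zero    c f = refl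
  sumTo-*ˡ (suc n) c f =
    trans (distribˡ c (sumTo n f) (f (suc n))) (cong (_+ c * f (suc n)) (sumTo-*ˡ n c f))

  antidiagonal : ℕ → (ℕ → ℕ → Carrier) → Carrier
  antidiagonal m g = sumTo m (λ k → g (m ℕ.∸ k) k)

  antidiagonal-first : ∀ m g → antidiagonal (suc m) g ≡ g (suc m) 0 + antidiagonal m (λ s k → g s (suc k))
  antidiagonal-first m g = sumTo-shift m (λ k → g (suc m ℕ.∸ k) k)

  antidiagonal-last : ∀ m g → antidiagonal (suc m) g ≡ antidiagonal m (λ s → g (suc s)) + g 0 (suc m)
  antidiagonal-last m g = cong₂ _+_
    (sumTo-cong m (λ k k≤m → cong (λ s → g s k) (ℕ.+-∸-assoc 1 k≤m)))
    (cong (λ s → g s (suc m)) (ℕ.n∸n≡0 m))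

  module _ (w : Carrier) where

    pathTerm : ℕ → ℕ → ℕ → Carrier
    pathTerm q s k = ι (paths q s k) * w ^ k

    -- coeff (suc r) m is the coefficient of U_r in φ^{2,w}_{r+2m}.
    coeff : ℕ → ℕ → Carrier
    coeff q m = antidiagonal m (pathTerm q)

    coeff-zeroˡ : ∀ m → coeff 0 m ≡ 0#
    coeff-zeroˡ m = trans (sumTo-cong m (λ k _ → zeroˡ (w ^ k))) (sumTo-zero m)
      where
      sumTo-zero : ∀ n → sumTo n (λ _ → 0#) ≡ 0#
      sumTo-zero zero    = refl
      sumTo-zero (suc n) = trans (cong (_+ 0#) (sumTo-zero n)) (+-identityʳ 0#)

    coeff-zeroʳ : ∀ q → coeff (suc q) 0 ≡ 1#
    coeff-zeroʳ q = trans (*-identityʳ (1# + 0#)) (+-identityʳ 1#)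

    private
      ι-+-* : ∀ a b y → ι (a ℕ.+ b) * y ≡ ι a * y + ι b * y
      ι-+-* a b y = trans (cong (_* y) (ι-+ a b)) (distribʳ y (ι a) (ι b))

      ι-*-w : ∀ c k → ι c * (w * w ^ k) ≡ w * (ι c * w ^ k)
      ι-*-w c k = solve 3 (λ c w wᵏ → c :* (w :* wᵏ) := w :* (c :* wᵏ)) refl (ι c) w (w ^ k)

    module _ (q : ℕ) where
      private
        down level : ℕ → ℕ → Carrier
        down zero    k = 0#
        down (suc s) k = pathTerm (suc (suc q)) s k
        level s zero    = 0#
        level s (suc k) = w * pathTerm (suc q) s k

        pathTerm-split : ∀ s k {n} → s ℕ.+ k ≡ suc n →
          pathTerm (suc q) s k ≡ pathTerm q s k + down s k + level s k
        pathTerm-split zero    zero    ()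
        pathTerm-split (suc s) zero    _ =
          trans (ι-+-* (paths q (suc s) 0) _ 1#) (sym (+-identityʳ _))
        pathTerm-split zero    (suc k) _ =
          trans (ι-+-* (paths q 0 (suc k)) _ (w * w ^ k))
                (cong₂ _+_ (sym (+-identityʳ _)) (ι-*-w (paths (suc q) 0 k) k))
        pathTerm-split (suc s) (suc k) _ =
          trans (ι-+-* (paths q (suc s) (suc k) ℕ.+ paths (suc (suc q)) s (suc k)) _ (w * w ^ k))
                (cong₂ _+_ (ι-+-* (paths q (suc s) (suc k)) _ (w * w ^ k)) (ι-*-w (paths (suc q) (suc s) k) k))

      coeff-rec : ∀ m → coeff (suc q) (suc m) ≡ coeff q (suc m) + coeff (suc (suc q)) m + w * coeff (suc q) m
      coeff-rec m = begin
        antidiagonal (suc m) (pathTerm (suc q))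
          ≡⟨ sumTo-cong (suc m) (λ k k≤1+m → pathTerm-split (suc m ℕ.∸ k) k (ℕ.m∸n+n≡m k≤1+m)) ⟩
        antidiagonal (suc m) (λ s k → pathTerm q s k + down s k + level s k)
          ≡⟨ sumTo-+ (suc m) _ _ ⟩
        _ ≡⟨ cong (_+ antidiagonal (suc m) level) (sumTo-+ (suc m) _ _) ⟩
        coeff q (suc m) + antidiagonal (suc m) down + antidiagonal (suc m) level
          ≡⟨ cong₂ (λ d l → coeff q (suc m) + d + l)
               (trans (antidiagonal-last m down) (+-identityʳ _))
               (trans (antidiagonal-first m level) (+-identityˡ _)) ⟩
        coeff q (suc m) + coeff (suc (suc q)) m + antidiagonal m (λ s k → w * pathTerm (suc q) s k)
          ≡⟨ cong (coeff q (suc m) + coeff (suc (suc q)) m +_) (sumTo-*ˡ m w _) ⟨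
        coeff q (suc m) + coeff (suc (suc q)) m + w * coeff (suc q) m ∎

    U-rec : ∀ j x → U (suc (suc j)) x + U j x ≡ ι 2 * x * U (suc j) x
    U-rec j x = begin
      ι 2 * x * U (suc j) x + - U j x + U j x   ≡⟨ +-assoc _ (- U j x) (U j x) ⟩
      ι 2 * x * U (suc j) x + (- U j x + U j x) ≡⟨ cong (ι 2 * x * U (suc j) x +_) (-‿inverseˡ (U j x)) ⟩
      ι 2 * x * U (suc j) x + 0#                ≡⟨ +-identityʳ _ ⟩
      ι 2 * x * U (suc j) x                     ∎

    module _ (x : Carrier) where

      chebSum : ℕ → ℕ → Carrier
      chebSum j n = sumTo n (λ m → coeff (suc (2 ℕ.* (n ℕ.∸ m) ℕ.+ j)) m * U (2 ℕ.* (n ℕ.∸ m) ℕ.+ j) x)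

      chebSum-last : ∀ j n → chebSum j (suc n) ≡ chebSum (suc (suc j)) n + coeff (suc j) (suc n) * U j x
      chebSum-last j n = cong₂ _+_
        (sumTo-cong n (λ m m≤n → cong (λ d → coeff (suc d) m * U d x) (degree-shift j n m m≤n)))
        (cong (λ d → coeff (suc (2 ℕ.* d ℕ.+ j)) (suc n) * U (2 ℕ.* d ℕ.+ j) x) (ℕ.n∸n≡0 n))

      chebSum-boundary : ∀ j n →
        coeff (suc (suc j)) n * U (suc (suc j)) x + coeff (suc j) (suc n) * U j x
          ≡ ι 2 * x * (coeff (suc (suc j)) n * U (suc j) x) + w * (coeff (suc j) n * U j x)
            + coeff j (suc n) * U j x
      chebSum-boundary j n = begin
        c₂ * U (suc (suc j)) x + coeff (suc j) (suc n) * U j x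
          ≡⟨ cong (λ c → c₂ * U (suc (suc j)) x + c * U j x) (coeff-rec j n) ⟩
        c₂ * U (suc (suc j)) x + (c₀ + c₂ + w * c₁) * U j x
          ≡⟨ solve 6 (λ c₀ c₁ c₂ w u₂ u₀ → c₂ :* u₂ :+ (c₀ :+ c₂ :+ w :* c₁) :* u₀
                        := c₂ :* (u₂ :+ u₀) :+ w :* (c₁ :* u₀) :+ c₀ :* u₀)
               refl c₀ c₁ c₂ w (U (suc (suc j)) x) (U j x) ⟩
        c₂ * (U (suc (suc j)) x + U j x) + w * (c₁ * U j x) + c₀ * U j x
          ≡⟨ cong (λ u → c₂ * u + w * (c₁ * U j x) + c₀ * U j x) (U-rec j x) ⟩
        c₂ * (ι 2 * x * U (suc j) x) + w * (c₁ * U j x) + c₀ * U j x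
          ≡⟨ cong (λ t → t + w * (c₁ * U j x) + c₀ * U j x)
               (solve 3 (λ c t u → c :* (t :* u) := t :* (c :* u)) refl c₂ (ι 2 * x) (U (suc j) x)) ⟩
        ι 2 * x * (c₂ * U (suc j) x) + w * (c₁ * U j x) + c₀ * U j x ∎
        where
        c₀ = coeff j (suc n)
        c₁ = coeff (suc j) n
        c₂ = coeff (suc (suc j)) n

      -- The last term vanishes for j = 0 because coeff 0 _ = 0; for j = 1 it is the U_1 = 2x U_0
      -- contributed by the last term of chebSum 0 (suc n).
      chebSum-rec : ∀ j n →
        chebSum j (suc n) ≡ ι 2 * x * chebSum (suc j) n + w * chebSum j n + coeff j (suc n) * U j x
      chebSum-rec j zero    = chebSum-boundary j 0
      chebSum-rec j (suc n) = begin
        chebSum j (suc (suc n))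
          ≡⟨ chebSum-last j (suc n) ⟩
        chebSum (2 ℕ.+ j) (suc n) + coeff (suc j) (suc (suc n)) * U j x
          ≡⟨ cong (_+ coeff (suc j) (suc (suc n)) * U j x) (chebSum-rec (2 ℕ.+ j) n) ⟩
        ι 2 * x * chebSum (3 ℕ.+ j) n + w * chebSum (2 ℕ.+ j) n + coeff (2 ℕ.+ j) (suc n) * U (2 ℕ.+ j) x
          + coeff (suc j) (suc (suc n)) * U j x
          ≡⟨ +-assoc _ _ _ ⟩
        ι 2 * x * chebSum (3 ℕ.+ j) n + w * chebSum (2 ℕ.+ j) n
          + (coeff (2 ℕ.+ j) (suc n) * U (2 ℕ.+ j) x + coeff (suc j) (suc (suc n)) * U j x)
          ≡⟨ cong (ι 2 * x * chebSum (3 ℕ.+ j) n + w * chebSum (2 ℕ.+ j) n +_) (chebSum-boundary j (suc n)) ⟩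
        ι 2 * x * chebSum (3 ℕ.+ j) n + w * chebSum (2 ℕ.+ j) n
          + (ι 2 * x * (coeff (2 ℕ.+ j) (suc n) * U (suc j) x) + w * (coeff (suc j) (suc n) * U j x)
             + coeff j (suc (suc n)) * U j x)
          ≡⟨ solve 7 (λ t a b p q w z → t :* a :+ w :* b :+ (t :* p :+ w :* q :+ z)
                        := t :* (a :+ p) :+ w :* (b :+ q) :+ z)
               refl (ι 2 * x) (chebSum (3 ℕ.+ j) n) (chebSum (2 ℕ.+ j) n)
               (coeff (2 ℕ.+ j) (suc n) * U (suc j) x) (coeff (suc j) (suc n) * U j x) w
               (coeff j (suc (suc n)) * U j x) ⟩
        ι 2 * x * (chebSum (3 ℕ.+ j) n + coeff (2 ℕ.+ j) (suc n) * U (suc j) x)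
          + w * (chebSum (2 ℕ.+ j) n + coeff (suc j) (suc n) * U j x) + coeff j (suc (suc n)) * U j x
          ≡⟨ cong₂ (λ a b → ι 2 * x * a + w * b + coeff j (suc (suc n)) * U j x)
               (chebSum-last (suc j) n) (chebSum-last j n) ⟨
        ι 2 * x * chebSum (suc j) (suc n) + w * chebSum j (suc n) + coeff j (suc (suc n)) * U j x ∎

      φ-chebSum : ∀ n → φ (ι 2) w (2 ℕ.* n) x ≡ chebSum 0 n × φ (ι 2) w (suc (2 ℕ.* n)) x ≡ chebSum 1 n
      φ-chebSum zero    = sym (trans (cong (_* 1#) (coeff-zeroʳ 0)) (*-identityʳ 1#))
                        , sym (trans (cong (_* (ι 2 * x)) (coeff-zeroʳ 1)) (*-identityˡ (ι 2 * x)))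
      φ-chebSum (suc n) =
          subst (λ i → φ (ι 2) w i x ≡ chebSum 0 (suc n)) (sym (ℕ.*-suc 2 n)) even
        , subst (λ i → φ (ι 2) w (suc i) x ≡ chebSum 1 (suc n)) (sym (ℕ.*-suc 2 n)) odd
        where
        even : φ (ι 2) w (2 ℕ.+ 2 ℕ.* n) x ≡ chebSum 0 (suc n)
        even = begin
          ι 2 * x * φ (ι 2) w (suc (2 ℕ.* n)) x + w * φ (ι 2) w (2 ℕ.* n) x
            ≡⟨ cong₂ (λ a b → ι 2 * x * a + w * b) (proj₂ (φ-chebSum n)) (proj₁ (φ-chebSum n)) ⟩
          ι 2 * x * chebSum 1 n + w * chebSum 0 n
            ≡⟨ +-identityʳ _ ⟨
          ι 2 * x * chebSum 1 n + w * chebSum 0 n + 0#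
            ≡⟨ cong (ι 2 * x * chebSum 1 n + w * chebSum 0 n +_)
                 (trans (cong (_* 1#) (coeff-zeroˡ (suc n))) (zeroˡ 1#)) ⟨
          ι 2 * x * chebSum 1 n + w * chebSum 0 n + coeff 0 (suc n) * U 0 x
            ≡⟨ chebSum-rec 0 n ⟨
          chebSum 0 (suc n) ∎
        odd : φ (ι 2) w (3 ℕ.+ 2 ℕ.* n) x ≡ chebSum 1 (suc n)
        odd = begin
          ι 2 * x * φ (ι 2) w (2 ℕ.+ 2 ℕ.* n) x + w * φ (ι 2) w (suc (2 ℕ.* n)) x
            ≡⟨ cong₂ (λ a b → ι 2 * x * a + w * b) even (proj₂ (φ-chebSum n)) ⟩
          ι 2 * x * chebSum 0 (suc n) + w * chebSum 1 n
            ≡⟨ cong (λ a → ι 2 * x * a + w * chebSum 1 n) (chebSum-last 0 n) ⟩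
          ι 2 * x * (chebSum 2 n + coeff 1 (suc n) * 1#) + w * chebSum 1 n
            ≡⟨ solve 5 (λ t a c v b → t :* (a :+ c :* con 1) :+ v :* b := t :* a :+ v :* b :+ c :* t)
                 refl (ι 2 * x) (chebSum 2 n) (coeff 1 (suc n)) w (chebSum 1 n) ⟩
          ι 2 * x * chebSum 2 n + w * chebSum 1 n + coeff 1 (suc n) * (ι 2 * x)
            ≡⟨ chebSum-rec 1 n ⟨
          chebSum 1 (suc n) ∎

      φ-chebSum-parity : ∀ j n → j ℕ.< 2 → φ (ι 2) w (2 ℕ.* n ℕ.+ j) x ≡ chebSum j n
      φ-chebSum-parity zero          n _ =
        trans (cong (λ i → φ (ι 2) w i x) (ℕ.+-identityʳ (2 ℕ.* n))) (proj₁ (φ-chebSum n))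
      φ-chebSum-parity (suc zero)    n _ =
        trans (cong (λ i → φ (ι 2) w i x) (ℕ.+-comm (2 ℕ.* n) 1)) (proj₂ (φ-chebSum n))
      φ-chebSum-parity (suc (suc j)) n (ℕ.s≤s (ℕ.s≤s ()))

      chebyshev-expansion : ∀ i →
        φ (ι 2) w i x ≡ sumTo (i ℕ./ 2) (λ m → coeff (suc (i ℕ.∸ 2 ℕ.* m)) m * U (i ℕ.∸ 2 ℕ.* m) x)
      chebyshev-expansion i = begin
        φ (ι 2) w i x
          ≡⟨ cong (λ i′ → φ (ι 2) w i′ x) (2*[n/2]+n%2≡n i) ⟨
        φ (ι 2) w (2 ℕ.* (i ℕ./ 2) ℕ.+ i ℕ.% 2) x
          ≡⟨ φ-chebSum-parity (i ℕ.% 2) (i ℕ./ 2) (m%n<n i 2) ⟩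
        chebSum (i ℕ.% 2) (i ℕ./ 2)
          ≡⟨ sumTo-cong (i ℕ./ 2) (λ m m≤i/2 → cong (λ d → coeff (suc d) m * U d x)
               (trans (degree-∸ (i ℕ.% 2) (i ℕ./ 2) m m≤i/2) (cong (ℕ._∸ 2 ℕ.* m) (2*[n/2]+n%2≡n i)))) ⟩
        sumTo (i ℕ./ 2) (λ m → coeff (suc (i ℕ.∸ 2 ℕ.* m)) m * U (i ℕ.∸ 2 ℕ.* m) x) ∎

  φ-scale : ∀ h c v i y → φ (h * c) (h * h * v) i y ≡ h ^ i * φ c v i y
  φ-scale h c v zero          y = sym (*-identityˡ 1#)
  φ-scale h c v (suc zero)    y = solve 3 (λ h c y → h :* c :* y := h :* con 1 :* (c :* y)) refl h c y
  φ-scale h c v (suc (suc i)) y = begin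
    h * c * y * φ (h * c) (h * h * v) (suc i) y + h * h * v * φ (h * c) (h * h * v) i y
      ≡⟨ cong₂ (λ a b → h * c * y * a + h * h * v * b) (φ-scale h c v (suc i) y) (φ-scale h c v i y) ⟩
    h * c * y * (h * h ^ i * φ c v (suc i) y) + h * h * v * (h ^ i * φ c v i y)
      ≡⟨ solve 7 (λ h c y v hⁱ p₁ p₀ → h :* c :* y :* (h :* hⁱ :* p₁) :+ h :* h :* v :* (hⁱ :* p₀)
                    := h :* (h :* hⁱ) :* (c :* y :* p₁ :+ v :* p₀))
           refl h c y v (h ^ i) (φ c v (suc i) y) (φ c v i y) ⟩
    h * (h * h ^ i) * (c * y * φ c v (suc i) y + v * φ c v i y) ∎

  /2*2≡id : ∀ a → a / ι 2 * ι 2 ≡ a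
  /2*2≡id a = begin
    a * ι 2 ⁻¹ * ι 2   ≡⟨ *-assoc a (ι 2 ⁻¹) (ι 2) ⟩
    a * (ι 2 ⁻¹ * ι 2) ≡⟨ cong (a *_) (trans (*-comm (ι 2 ⁻¹) (ι 2)) (⁻¹-inverse (ι 2) (ι-suc≢0 1))) ⟩
    a * 1#             ≡⟨ *-identityʳ a ⟩
    a                  ∎

  [a/2]²*4b/a²≡b : ∀ {a} b → a ≢ 0# → a / ι 2 * (a / ι 2) * (ι 4 * b / (a ^ 2)) ≡ b
  [a/2]²*4b/a²≡b {a} b a≢0 = begin
    a * t⁻¹ * (a * t⁻¹) * (ι 4 * b * (a * (a * 1#)) ⁻¹)
      ≡⟨ cong₂ (λ u v → a * t⁻¹ * (a * t⁻¹) * (u * b * v ⁻¹)) (ι-* 2 2) (cong (a *_) (*-identityʳ a)) ⟩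
    a * t⁻¹ * (a * t⁻¹) * (ι 2 * ι 2 * b * (a * a) ⁻¹)
      ≡⟨ cong (λ u → a * t⁻¹ * (a * t⁻¹) * (ι 2 * ι 2 * b * u)) (⁻¹-distrib-* a≢0 a≢0) ⟩
    a * t⁻¹ * (a * t⁻¹) * (ι 2 * ι 2 * b * (a ⁻¹ * a ⁻¹))
      ≡⟨ solve 5 (λ a t′ t b a′ → a :* t′ :* (a :* t′) :* (t :* t :* b :* (a′ :* a′))
                    := (a :* a′) :* (a :* a′) :* (t :* t′) :* (t :* t′) :* b)
           refl a t⁻¹ (ι 2) b (a ⁻¹) ⟩
    (a * a ⁻¹) * (a * a ⁻¹) * (ι 2 * t⁻¹) * (ι 2 * t⁻¹) * b
      ≡⟨ cong₂ (λ u v → u * u * v * v * b) (⁻¹-inverse a a≢0) (⁻¹-inverse (ι 2) (ι-suc≢0 1)) ⟩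
    1# * 1# * 1# * 1# * b
      ≡⟨ solve 1 (λ b → con 1 :* con 1 :* con 1 :* con 1 :* b := b) refl b ⟩
    b ∎
    where
    t⁻¹ = ι 2 ⁻¹

  hyperterm : Carrier → Carrier → Carrier → Carrier → ℕ → Carrier
  hyperterm α β γ z k = (poch α k * poch β k) / poch γ k * (z ^ k) / fact k

  fact-≢0 : ∀ k → fact k ≢ 0#
  fact-≢0 zero    1≡0 = 0≢1 (sym 1≡0)
  fact-≢0 (suc k)     = *-≢0 (fact-≢0 k) (ι-suc≢0 k)

  poch-≢0 : ∀ γ k → (∀ j → j ℕ.< k → γ + ι j ≢ 0#) → poch γ k ≢ 0#
  poch-≢0 γ zero    _       1≡0 = 0≢1 (sym 1≡0)
  poch-≢0 γ (suc k) γ+j≢0       =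
    *-≢0 (poch-≢0 γ k (λ j j<k → γ+j≢0 j (ℕ.m<n⇒m<1+n j<k))) (γ+j≢0 k ℕ.≤-refl)

  hyperterm-zero : ∀ α β γ z → hyperterm α β γ z 0 ≡ 1#
  hyperterm-zero α β γ z = begin
    1# * 1# * 1# ⁻¹ * 1# * 1# ⁻¹ ≡⟨ cong (λ u → 1# * 1# * u * 1# * u) 1⁻¹≡1 ⟩
    1# * 1# * 1# * 1# * 1#       ≡⟨ solve 0 (con 1 :* con 1 :* con 1 :* con 1 :* con 1 := con 1) refl ⟩
    1#                           ∎

  hyperterm-suc : ∀ α β γ z k → (∀ j → j ℕ.≤ k → γ + ι j ≢ 0#) →
    hyperterm α β γ z (suc k)
      ≡ hyperterm α β γ z k * ((α + ι k) * (β + ι k) / (γ + ι k) * z / ι (suc k))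
  hyperterm-suc α β γ z k γ+j≢0 = begin
    A * a * (B * b) * (C * c) ⁻¹ * (z * z ^ k) * (fact k * ι (suc k)) ⁻¹
      ≡⟨ cong₂ (λ u v → A * a * (B * b) * u * (z * z ^ k) * v)
           (⁻¹-distrib-* C≢0 (γ+j≢0 k ℕ.≤-refl)) (⁻¹-distrib-* (fact-≢0 k) (ι-suc≢0 k)) ⟩
    A * a * (B * b) * (C ⁻¹ * c ⁻¹) * (z * z ^ k) * (fact k ⁻¹ * ι (suc k) ⁻¹)
      ≡⟨ solve 10 (λ A a B b C′ c′ z zᵏ f′ d′ →
                     A :* a :* (B :* b) :* (C′ :* c′) :* (z :* zᵏ) :* (f′ :* d′)
                       := A :* B :* C′ :* zᵏ :* f′ :* (a :* b :* c′ :* z :* d′))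
           refl A a B b (C ⁻¹) (c ⁻¹) z (z ^ k) (fact k ⁻¹) (ι (suc k) ⁻¹) ⟩
    A * B * C ⁻¹ * z ^ k * fact k ⁻¹ * (a * b * c ⁻¹ * z * ι (suc k) ⁻¹) ∎
    where
    A = poch α k
    a = α + ι k
    B = poch β k
    b = β + ι k
    C = poch γ k
    c = γ + ι k
    C≢0 = poch-≢0 γ k (λ j j<k → γ+j≢0 j (ℕ.<⇒≤ j<k))

  hyperterm-ratio : ∀ {p₁ p₂ a b c d} y W → c ≢ 0# → d ≢ 0# → p₁ * (c * d) ≡ p₂ * (a * b) →
    p₂ * W * ((- a) * (- b) / (- c) * (- y) / d) ≡ p₁ * (y * W)
  hyperterm-ratio {p₁} {p₂} {a} {b} {c} {d} y W c≢0 d≢0 p₁cd≡p₂ab = begin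
    p₂ * W * ((- a) * (- b) * (- c) ⁻¹ * (- y) * d ⁻¹)
      ≡⟨ cong₂ (λ u v → p₂ * W * (u * v * (- y) * d ⁻¹)) (-x*-y≡x*y a b) (⁻¹-distrib-neg c≢0) ⟩
    p₂ * W * (a * b * - c ⁻¹ * (- y) * d ⁻¹)
      ≡⟨ solve 7 (λ p W a b c′ y d′ → p :* W :* (a :* b :* c′ :* y :* d′)
                                        := p :* (a :* b) :* (c′ :* y) :* d′ :* W)
           refl p₂ W a b (- c ⁻¹) (- y) (d ⁻¹) ⟩
    p₂ * (a * b) * (- c ⁻¹ * - y) * d ⁻¹ * W
      ≡⟨ cong (λ u → p₂ * (a * b) * u * d ⁻¹ * W) (-x*-y≡x*y (c ⁻¹) y) ⟩
    p₂ * (a * b) * (c ⁻¹ * y) * d ⁻¹ * W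
      ≡⟨ solve 5 (λ q c′ y d′ W → q :* (c′ :* y) :* d′ :* W := q :* (c′ :* d′) :* (y :* W))
           refl (p₂ * (a * b)) (c ⁻¹) y (d ⁻¹) W ⟩
    p₂ * (a * b) * (c ⁻¹ * d ⁻¹) * (y * W)
      ≡⟨ cong (λ u → p₂ * (a * b) * u * (y * W)) (⁻¹-distrib-* c≢0 d≢0) ⟨
    p₂ * (a * b) / (c * d) * (y * W)
      ≡⟨ cong (_* (y * W)) (*≡⇒≡/ (*-≢0 c≢0 d≢0) p₁cd≡p₂ab) ⟨
    p₁ * (y * W) ∎

  ι-paths-ratio : ∀ r s k →
    ι (paths (suc r) s (suc k)) * (ι (suc (suc (r ℕ.+ 2 ℕ.* s ℕ.+ k))) * ι (suc k))
      ≡ ι (paths (suc r) (suc s) k) * (ι (suc s) * ι (suc (suc (r ℕ.+ s))))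
  ι-paths-ratio r s k = begin
    _ ≡⟨ ι-*₃ (paths (suc r) s (suc k)) (suc (suc (r ℕ.+ 2 ℕ.* s ℕ.+ k))) (suc k) ⟨
    _ ≡⟨ cong ι (paths-ratio r s k) ⟩
    _ ≡⟨ ι-*₃ (paths (suc r) (suc s) k) (suc s) (suc (suc (r ℕ.+ s))) ⟩
    _ ∎
    where
    ι-*₃ : ∀ p a b → ι (p ℕ.* (a ℕ.* b)) ≡ ι p * (ι a * ι b)
    ι-*₃ p a b = trans (ι-* p (a ℕ.* b)) (cong (ι p *_) (ι-* a b))

  module _ (w : Carrier) where

    private
      hypergeometricTerm : ℕ → ℕ → ℕ → Carrier
      hypergeometricTerm r m k = ι (paths (suc r) m 0)
        * hyperterm (- ι m) (- ι (suc (r ℕ.+ m))) (- ι (r ℕ.+ 2 ℕ.* m)) (- w) k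

    hyperterm-paths : ∀ r s k → hypergeometricTerm r (k ℕ.+ s) k ≡ pathTerm w (suc r) s k
    hyperterm-paths r s zero    =
      cong (ι (paths (suc r) s 0) *_)
           (hyperterm-zero (- ι s) (- ι (suc (r ℕ.+ s))) (- ι (r ℕ.+ 2 ℕ.* s)) (- w))
    hyperterm-paths r s (suc k) = begin
      ι (paths (suc r) m 0) * hyperterm α β γ (- w) (suc k)
        ≡⟨ cong (ι (paths (suc r) m 0) *_) (hyperterm-suc α β γ (- w) k γ+j≢0) ⟩
      ι (paths (suc r) m 0) * (hyperterm α β γ (- w) k * ρ)
        ≡⟨ *-assoc _ _ ρ ⟨
      hypergeometricTerm r m k * ρ
        ≡⟨ cong₂ _*_ (subst (λ m′ → hypergeometricTerm r m′ k ≡ pathTerm w (suc r) (suc s) k)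
                            (ℕ.+-suc k s) (hyperterm-paths r (suc s) k))
                     ρ≡ ⟩
      ι (paths (suc r) (suc s) k) * w ^ k * ((- ι a) * (- ι b) / (- ι (suc c)) * (- w) / ι (suc k))
        ≡⟨ hyperterm-ratio w (w ^ k) (ι-suc≢0 c) (ι-suc≢0 k) (ι-paths-ratio r s k) ⟩
      pathTerm w (suc r) s (suc k) ∎
      where
      m = suc (k ℕ.+ s)
      α = - ι m
      β = - ι (suc (r ℕ.+ m))
      γ = - ι (r ℕ.+ 2 ℕ.* m)
      ρ = (α + ι k) * (β + ι k) / (γ + ι k) * (- w) / ι (suc k)
      a = suc s
      b = suc (suc (r ℕ.+ s))
      c = suc (r ℕ.+ 2 ℕ.* s ℕ.+ k)
      -ι+ι≡ : ∀ {n} d → n ≡ d ℕ.+ k → - ι n + ι k ≡ - ι d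
      -ι+ι≡ d refl = -ι-+-cancel d k
      ρ≡ : ρ ≡ (- ι a) * (- ι b) / (- ι (suc c)) * (- w) / ι (suc k)
      ρ≡ = cong₂ (λ u v → u / v * (- w) / ι (suc k))
                 (cong₂ _*_ (-ι+ι≡ a (shape₁ r s k)) (-ι+ι≡ b (shape₂ r s k)))
                 (-ι+ι≡ (suc c) (shape₃ r s k))
        where
        shape₁ : ∀ r s k → suc (k ℕ.+ s) ≡ suc s ℕ.+ k
        shape₁ = solve-∀
        shape₂ : ∀ r s k → suc (r ℕ.+ suc (k ℕ.+ s)) ≡ suc (suc (r ℕ.+ s)) ℕ.+ k
        shape₂ = solve-∀
        shape₃ : ∀ r s k → r ℕ.+ 2 ℕ.* suc (k ℕ.+ s) ≡ suc (suc (r ℕ.+ 2 ℕ.* s ℕ.+ k)) ℕ.+ k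
        shape₃ = solve-∀
      γ+j≢0 : ∀ j → j ℕ.≤ k → γ + ι j ≢ 0#
      γ+j≢0 j j≤k = -ι+ι≢0 (ℕ.≤-<-trans j≤k (ℕ.<-≤-trans (ℕ.s≤s (ℕ.m≤m+n k s)) (m≤r+2*m r m)))
        where
        m≤r+2*m : ∀ r m → m ℕ.≤ r ℕ.+ 2 ℕ.* m
        m≤r+2*m r m = ℕ.≤-trans (ℕ.m≤m+n m (m ℕ.+ 0)) (ℕ.m≤n+m (2 ℕ.* m) r)

    hypergeometricCoeff : ℕ → ℕ → Carrier
    hypergeometricCoeff i m = (binom i m * (ι i + - ι (2 ℕ.* m) + 1#)) / (ι i + - ι m + 1#)
      * F21 m ((- ι i) + ι m + - 1#) (- ι i) (- w)

    prefactor≡paths : ∀ r m → let i = r ℕ.+ 2 ℕ.* m in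
      (binom i m * (ι i + - ι (2 ℕ.* m) + 1#)) / (ι i + - ι m + 1#) ≡ ι (paths (suc r) m 0)
    prefactor≡paths r m = begin
      (binom i m * (ι i + - ι (2 ℕ.* m) + 1#)) / (ι i + - ι m + 1#)
        ≡⟨ cong₂ (λ u v → binom i m * u / v) numerator denominator ⟩
      binom i m * ι (suc r) / ι (suc (r ℕ.+ m))
        ≡⟨ *≡⇒≡/ (ι-suc≢0 (r ℕ.+ m)) (begin
             ι (paths (suc r) m 0) * ι (suc (r ℕ.+ m)) ≡⟨ ι-* (paths (suc r) m 0) (suc (r ℕ.+ m)) ⟨
             ι (paths (suc r) m 0 ℕ.* suc (r ℕ.+ m))   ≡⟨ cong ι (paths-ballot r m) ⟨
             ι ((i C m) ℕ.* suc r)                     ≡⟨ ι-* (i C m) (suc r) ⟩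
             binom i m * ι (suc r)                     ∎) ⟨
      ι (paths (suc r) m 0) ∎
      where
      i = r ℕ.+ 2 ℕ.* m
      numerator : ι i + - ι (2 ℕ.* m) + 1# ≡ ι (suc r)
      numerator = trans (cong (_+ 1#) (ι-+-cancel r (2 ℕ.* m))) (+-comm (ι r) 1#)
      denominator : ι i + - ι m + 1# ≡ ι (suc (r ℕ.+ m))
      denominator = begin
        ι i + - ι m + 1#                 ≡⟨ cong (λ n → ι n + - ι m + 1#) (shape r m) ⟩
        ι (r ℕ.+ m ℕ.+ m) + - ι m + 1#   ≡⟨ cong (_+ 1#) (ι-+-cancel (r ℕ.+ m) m) ⟩
        ι (r ℕ.+ m) + 1#                 ≡⟨ +-comm (ι (r ℕ.+ m)) 1# ⟩
        ι (suc (r ℕ.+ m))                ∎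
        where
        shape : ∀ r m → r ℕ.+ 2 ℕ.* m ≡ r ℕ.+ m ℕ.+ m
        shape = solve-∀

    hypergeometricCoeff[r+2m]≡coeff : ∀ r m →
      hypergeometricCoeff (r ℕ.+ 2 ℕ.* m) m ≡ coeff w (suc r) m
    hypergeometricCoeff[r+2m]≡coeff r m = begin
      hypergeometricCoeff i m
        ≡⟨ cong₂ (λ u β → u * F21 m β (- ι i) (- w)) (prefactor≡paths r m) β≡ ⟩
      ι (paths (suc r) m 0) * sumTo m (hyperterm (- ι m) (- ι (suc (r ℕ.+ m))) (- ι i) (- w))
        ≡⟨ sumTo-*ˡ m _ _ ⟩
      sumTo m (hypergeometricTerm r m)
        ≡⟨ sumTo-cong m (λ k k≤m →
             subst (λ m′ → hypergeometricTerm r m′ k ≡ pathTerm w (suc r) (m ℕ.∸ k) k)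
                   (ℕ.m+[n∸m]≡n k≤m) (hyperterm-paths r (m ℕ.∸ k) k)) ⟩
      coeff w (suc r) m ∎
      where
      i = r ℕ.+ 2 ℕ.* m
      β≡ : - ι i + ι m + - 1# ≡ - ι (suc (r ℕ.+ m))
      β≡ = begin
        - ι i + ι m + - 1#              ≡⟨ cong (λ n → - ι n + ι m + - 1#) (shape r m) ⟩
        - ι (r ℕ.+ m ℕ.+ m) + ι m + - 1# ≡⟨ cong (_+ - 1#) (-ι-+-cancel (r ℕ.+ m) m) ⟩
        - ι (r ℕ.+ m) + - 1#            ≡⟨ +-comm (- ι (r ℕ.+ m)) (- 1#) ⟩
        - 1# + - ι (r ℕ.+ m)            ≡⟨ -‿distrib-+ 1# (ι (r ℕ.+ m)) ⟨
        - ι (suc (r ℕ.+ m))             ∎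
        where
        shape : ∀ r m → r ℕ.+ 2 ℕ.* m ≡ r ℕ.+ m ℕ.+ m
        shape = solve-∀

    hypergeometricCoeff≡coeff : ∀ i m → 2 ℕ.* m ℕ.≤ i →
      hypergeometricCoeff i m ≡ coeff w (suc (i ℕ.∸ 2 ℕ.* m)) m
    hypergeometricCoeff≡coeff i m 2m≤i =
      subst (λ i′ → hypergeometricCoeff i′ m ≡ coeff w (suc (i ℕ.∸ 2 ℕ.* m)) m)
            (ℕ.m∸n+n≡m 2m≤i) (hypergeometricCoeff[r+2m]≡coeff (i ℕ.∸ 2 ℕ.* m) m)

corollary5 : (R : RealField) → let open Poly R in
  (a b : Carrier) → a ≢ 0# → b ≢ 0# → (i : ℕ) → (x : Carrier) →
    φ a b i x ≡
      ((a / ι 2) ^ i) *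
        sumTo (i ℕ./ 2) (λ m →
          (binom i m * (ι i + - ι (2 ℕ.* m) + 1#)) / (ι i + - ι m + 1#)
          * F21 m ((- ι i) + ι m + - 1#) (- ι i) (- (ι 4 * b / (a ^ 2)))
          * U (i ℕ.∸ 2 ℕ.* m) x)
corollary5 R a b a≢0 _ i x = begin
  φ a b i x
    ≡⟨ cong₂ (λ a′ b′ → φ a′ b′ i x) (/2*2≡id R a) ([a/2]²*4b/a²≡b R b a≢0) ⟨
  φ (h * ι 2) (h * h * w) i x
    ≡⟨ φ-scale R h (ι 2) w i x ⟩
  h ^ i * φ (ι 2) w i x
    ≡⟨ cong (h ^ i *_) (chebyshev-expansion R w x i) ⟩
  h ^ i * sumTo (i ℕ./ 2) (λ m → coeff R w (suc (i ℕ.∸ 2 ℕ.* m)) m * U (i ℕ.∸ 2 ℕ.* m) x)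
    ≡⟨ cong (h ^ i *_) (sumTo-cong R (i ℕ./ 2) λ m m≤i/2 →
         cong (_* U (i ℕ.∸ 2 ℕ.* m) x) (hypergeometricCoeff≡coeff R w i m (m≤n/2⇒2*m≤n i m≤i/2))) ⟨
  h ^ i * sumTo (i ℕ./ 2) (λ m → hypergeometricCoeff R w i m * U (i ℕ.∸ 2 ℕ.* m) x) ∎
  where
  open Poly R
  h = a / ι 2
  w = ι 4 * b / (a ^ 2)
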